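{- Let $\mathbf{A}$ be a normal and quasicomplemented distributive nearlattice and let $F$ be an $\alpha$-filter of $A$. Then $I_F=\{x\in A\colon \exists f\in F\ (x^{\top}\subseteq f^{\top\top})\}$ is an $\alpha$-ideal of $A$.
   Context: A distributive nearlattice is a join-semilattice $\langle A,\vee,1\rangle$ with greatest element $1$ in which every principal filter $[a)=\{x\in A\colon a\le x\}$ is a bounded distributive lattice. A filter of $A$ is a subset containing $1$, upward closed, and closed under those binary meets that exist. An ideal is a downward closed, $\vee$-closed subset; a prime ideal is a non-empty proper ideal $P$ with $a\wedge b\in P\Rightarrow a\in P$ or $b\in P$ whenever $a\wedge b$ exists; a maximal ideal is a non-empty proper ideal not properly contained in any proper ideal. For $a\in A$, $a^{\top}=\{x\in A\colon x\vee a=1\}$ and $a^{\top\top}=\{y\in A\colon y\vee x=1\text{ for all }x\in a^{\top}\}$. A filter $F$ is an $\alpha$-filter if $a^{\top\top}\subseteq F$ for all $a\in F$. An ideal $I$ is an $\alpha$-ideal if for each $a\in A$, $I\cap a^{\top\top}\ne\emptyset$ implies $a\in I$. $\mathbf{A}$ is normal if each prime ideal is contained in a unique maximal ideal; $\mathbf{A}$ is quasicomplemented if for each $a\in A$ there exists $b\in A$ with $a^{\top\top}=b^{\top}$. -}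

module Defs where

open import Data.Product using (Σ; _×_; ∃; ∃-syntax; _,_)
open import Data.Sum using (_⊎_)
open import Relation.Binary.PropositionalEquality using (_≡_)
open import Relation.Unary using (Pred; _∈_; _∉_; _⊆_; _≐_)
open import Level using (0ℓ)

record JoinSemilattice1 : Set₁ where
  infixr 6 _∨_
  infix 4 _≤_
  field
    Carrier : Set
    _∨_     : Carrier → Carrier → Carrier
    𝟙       : Carrier
    ∨-assoc : ∀ x y z → (x ∨ y) ∨ z ≡ x ∨ (y ∨ z)
    ∨-comm  : ∀ x y → x ∨ y ≡ y ∨ x
    ∨-idem  : ∀ x → x ∨ x ≡ x
    ∨-top   : ∀ x → x ∨ 𝟙 ≡ 𝟙

  _≤_ : Carrier → Carrier → Set
  x ≤ y = x ∨ y ≡ y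

  IsMeet : Carrier → Carrier → Carrier → Set
  IsMeet x y m = (m ≤ x) × (m ≤ y) × (∀ c → c ≤ x → c ≤ y → c ≤ m)

-- Distributive nearlattice: every principal filter [a) is a (bounded, with
-- bounds a and 1) distributive lattice.  Meets in [a) coincide with meets in A
-- (any lower bound c of x,y ∈ [a) gives the lower bound c ∨ a ∈ [a)).
record DistributiveNearlattice : Set₁ where
  field
    semilattice : JoinSemilattice1
  open JoinSemilattice1 semilattice public
  field
    principal-meet : ∀ a x y → a ≤ x → a ≤ y → ∃[ m ] IsMeet x y m
    principal-distrib : ∀ a x y z → a ≤ x → a ≤ y → a ≤ z →
      ∀ m₁ m₂ m₃ → IsMeet x (y ∨ z) m₁ → IsMeet x y m₂ → IsMeet x z m₃ →
      m₁ ≡ m₂ ∨ m₃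

module _ (𝐀 : DistributiveNearlattice) where
  open DistributiveNearlattice 𝐀

  Subset : Set₁
  Subset = Pred Carrier 0ℓ

  _ᵀ : Carrier → Subset
  (a ᵀ) x = x ∨ a ≡ 𝟙

  _ᵀᵀ : Carrier → Subset
  (a ᵀᵀ) y = ∀ x → x ∈ (a ᵀ) → y ∨ x ≡ 𝟙

  IsFilter : Subset → Set
  IsFilter F = (𝟙 ∈ F)
             × (∀ x y → x ∈ F → x ≤ y → y ∈ F)
             × (∀ x y m → x ∈ F → y ∈ F → IsMeet x y m → m ∈ F)

  IsIdeal : Subset → Set
  IsIdeal I = (∀ x y → y ∈ I → x ≤ y → x ∈ I)
            × (∀ x y → x ∈ I → y ∈ I → (x ∨ y) ∈ I)

  NonEmpty : Subset → Set
  NonEmpty I = ∃[ x ] x ∈ I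

  Proper : Subset → Set
  Proper I = ∃[ x ] x ∉ I

  IsPrimeIdeal : Subset → Set
  IsPrimeIdeal P = IsIdeal P × NonEmpty P × Proper P
                 × (∀ a b m → IsMeet a b m → m ∈ P → a ∈ P ⊎ b ∈ P)

  IsMaximalIdeal : Subset → Set₁
  IsMaximalIdeal M = IsIdeal M × NonEmpty M × Proper M
                   × (∀ J → IsIdeal J → Proper J → M ⊆ J → J ⊆ M)

  IsNormal : Set₁
  IsNormal = ∀ P → IsPrimeIdeal P →
    Σ Subset λ M → IsMaximalIdeal M × P ⊆ M ×
      (∀ M′ → IsMaximalIdeal M′ → P ⊆ M′ → M′ ≐ M)

  IsQuasicomplemented : Set
  IsQuasicomplemented = ∀ a → ∃[ b ] ((a ᵀᵀ) ≐ (b ᵀ))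

  IsαFilter : Subset → Set
  IsαFilter F = IsFilter F × (∀ a → a ∈ F → (a ᵀᵀ) ⊆ F)

  IsαIdeal : Subset → Set
  IsαIdeal I = IsIdeal I × (∀ a → (∃[ x ] (x ∈ I × x ∈ (a ᵀᵀ))) → a ∈ I)

  I[_] : Subset → Subset
  I[ F ] x = ∃[ f ] (f ∈ F × (x ᵀ) ⊆ (f ᵀᵀ))

-- Down-closure and the α-property of I_F follow from x ≤ y ⇒ x^⊤ ⊆ y^⊤ and from
-- x^⊤ ⊆ f^⊤⊤ ⇔ f^⊤ ⊆ x^⊤⊤.  For closure under joins, let x^⊤ ⊆ f^⊤⊤, y^⊤ ⊆ g^⊤⊤
-- with f, g ∈ F, and use quasicomplementation to pick c with (x ∨ y)^⊤⊤ = c^⊤.  The meet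
-- m = (f ∨ c) ∧ (g ∨ c) lies in F, and every s ∈ m^⊤ lies in c^⊤: the element u = s ∨ c is
-- orthogonal to f and g, hence lies in x^⊤⊤ ∩ y^⊤⊤ ∩ (x ∨ y)^⊤, which forces u = 1.
-- Thus m^⊤ ⊆ c^⊤ = (x ∨ y)^⊤⊤, i.e. (x ∨ y)^⊤ ⊆ m^⊤⊤.
module Submission where

open import Defs hiding (_ᵀ; _ᵀᵀ)
open import Data.Product using (_×_; ∃-syntax; _,_; proj₁; proj₂)
open import Relation.Binary.PropositionalEquality using (_≡_; sym; trans; cong; module ≡-Reasoning)
open import Relation.Unary using (_∈_; _⊆_)

module Orthogonality (𝐀 : DistributiveNearlattice) where
  open DistributiveNearlattice 𝐀
  open ≡-Reasoning

  _ᵀ : Carrier → Subset 𝐀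
  _ᵀ = Defs._ᵀ 𝐀

  _ᵀᵀ : Carrier → Subset 𝐀
  _ᵀᵀ = Defs._ᵀᵀ 𝐀

  x≤x∨y : ∀ x y → x ≤ x ∨ y
  x≤x∨y x y = trans (sym (∨-assoc x x y)) (cong (_∨ y) (∨-idem x))

  y≤x∨y : ∀ x y → y ≤ x ∨ y
  y≤x∨y x y = trans (cong (y ∨_) (∨-comm x y)) (trans (x≤x∨y y x) (∨-comm y x))

  ᵀ-sym : ∀ {x y} → x ∈ y ᵀ → y ∈ x ᵀ
  ᵀ-sym {x} {y} xy = trans (∨-comm y x) xy

  ᵀ-mono : ∀ {x y} → x ≤ y → x ᵀ ⊆ y ᵀ
  ᵀ-mono {x} {y} x≤y {t} tx = begin
    t ∨ y        ≡⟨ cong (t ∨_) (sym x≤y) ⟩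
    t ∨ (x ∨ y)  ≡⟨ sym (∨-assoc t x y) ⟩
    (t ∨ x) ∨ y  ≡⟨ cong (_∨ y) tx ⟩
    𝟙 ∨ y        ≡⟨ ∨-comm 𝟙 y ⟩
    y ∨ 𝟙        ≡⟨ ∨-top y ⟩
    𝟙            ∎

  ᵀ-upClosed : ∀ {a x y} → x ≤ y → x ∈ a ᵀ → y ∈ a ᵀ
  ᵀ-upClosed x≤y xa = ᵀ-sym (ᵀ-mono x≤y (ᵀ-sym xa))

  ∈ᵀᵀ : ∀ x → x ∈ x ᵀᵀ
  ∈ᵀᵀ x t tx = ᵀ-sym tx

  ∈ᵀᵀ⇒ᵀ⊆ᵀ : ∀ {a x} → x ∈ a ᵀᵀ → a ᵀ ⊆ x ᵀ
  ∈ᵀᵀ⇒ᵀ⊆ᵀ xa {t} ta = ᵀ-sym (xa t ta)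

  ᵀ⊆ᵀᵀ-swap : ∀ {x f} → x ᵀ ⊆ f ᵀᵀ → f ᵀ ⊆ x ᵀᵀ
  ᵀ⊆ᵀᵀ-swap x⊆f {u} uf t tx = ᵀ-sym (x⊆f tx u uf)

  ᵀᵀ∩ᵀ⇒𝟙 : ∀ {x u} → u ∈ x ᵀᵀ → u ∈ x ᵀ → u ≡ 𝟙
  ᵀᵀ∩ᵀ⇒𝟙 {u = u} ux ux′ = trans (sym (∨-idem u)) (ux u ux′)

  ∨ᵀ-shift : ∀ {x y u} → u ∈ (x ∨ y) ᵀ → (u ∨ y) ∈ x ᵀ
  ∨ᵀ-shift {x} {y} {u} uxy = begin
    (u ∨ y) ∨ x  ≡⟨ ∨-assoc u y x ⟩
    u ∨ (y ∨ x)  ≡⟨ cong (u ∨_) (∨-comm y x) ⟩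
    u ∨ (x ∨ y)  ≡⟨ uxy ⟩
    𝟙            ∎

  ᵀᵀ∩∨ᵀ⇒ᵀ : ∀ {x y u} → u ∈ x ᵀᵀ → u ∈ (x ∨ y) ᵀ → u ∈ y ᵀ
  ᵀᵀ∩∨ᵀ⇒ᵀ {x} {y} {u} ux uxy = begin
    u ∨ y        ≡⟨ sym (x≤x∨y u y) ⟩
    u ∨ (u ∨ y)  ≡⟨ ux (u ∨ y) (∨ᵀ-shift uxy) ⟩
    𝟙            ∎

  ᵀᵀ∩ᵀᵀ∩∨ᵀ⇒𝟙 : ∀ {x y u} → u ∈ x ᵀᵀ → u ∈ y ᵀᵀ → u ∈ (x ∨ y) ᵀ → u ≡ 𝟙
  ᵀᵀ∩ᵀᵀ∩∨ᵀ⇒𝟙 ux uy uxy = ᵀᵀ∩ᵀ⇒𝟙 uy (ᵀᵀ∩∨ᵀ⇒ᵀ ux uxy)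

  ∨ᵀ-rotate : ∀ {s f c} → s ∈ (f ∨ c) ᵀ → (s ∨ c) ∈ f ᵀ
  ∨ᵀ-rotate {s} {f} {c} sfc = begin
    (s ∨ c) ∨ f  ≡⟨ ∨-assoc s c f ⟩
    s ∨ (c ∨ f)  ≡⟨ cong (s ∨_) (∨-comm c f) ⟩
    s ∨ (f ∨ c)  ≡⟨ sfc ⟩
    𝟙            ∎

  ᵀ-below-meet : ∀ {x y f g c m} → x ᵀ ⊆ f ᵀᵀ → y ᵀ ⊆ g ᵀᵀ → c ∈ (x ∨ y) ᵀ →
                 m ≤ f ∨ c → m ≤ g ∨ c → m ᵀ ⊆ c ᵀ
  ᵀ-below-meet {c = c} x⊆f y⊆g cxy m≤fc m≤gc {s} sm =
    ᵀᵀ∩ᵀᵀ∩∨ᵀ⇒𝟙 (ᵀ⊆ᵀᵀ-swap x⊆f (∨ᵀ-rotate (ᵀ-mono m≤fc sm)))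
               (ᵀ⊆ᵀᵀ-swap y⊆g (∨ᵀ-rotate (ᵀ-mono m≤gc sm)))
               (ᵀ-upClosed (y≤x∨y s c) cxy)

  module _ (F : Subset 𝐀) (isFilter : IsFilter 𝐀 F) where
    private
      F-upClosed = proj₁ (proj₂ isFilter)
      F-meetClosed = proj₂ (proj₂ isFilter)

    I-downClosed : ∀ x y → y ∈ I[_] 𝐀 F → x ≤ y → x ∈ I[_] 𝐀 F
    I-downClosed x y (f , f∈F , y⊆f) x≤y = f , f∈F , λ tx → y⊆f (ᵀ-mono x≤y tx)

    I-∨-closed : IsQuasicomplemented 𝐀 →
                 ∀ x y → x ∈ I[_] 𝐀 F → y ∈ I[_] 𝐀 F → (x ∨ y) ∈ I[_] 𝐀 F
    I-∨-closed quasi x y (f , f∈F , x⊆f) (g , g∈F , y⊆g) = m , m∈F , xyᵀ⊆mᵀᵀ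
      where
      c = proj₁ (quasi (x ∨ y))
      xyᵀᵀ⊆cᵀ = proj₁ (proj₂ (quasi (x ∨ y)))
      cᵀ⊆xyᵀᵀ = proj₂ (proj₂ (quasi (x ∨ y)))
      meet = principal-meet c (f ∨ c) (g ∨ c) (y≤x∨y f c) (y≤x∨y g c)
      m = proj₁ meet
      m∈F : m ∈ F
      m∈F = F-meetClosed (f ∨ c) (g ∨ c) m
              (F-upClosed f (f ∨ c) f∈F (x≤x∨y f c))
              (F-upClosed g (g ∨ c) g∈F (x≤x∨y g c))
              (proj₂ meet)
      mᵀ⊆cᵀ : m ᵀ ⊆ c ᵀ
      mᵀ⊆cᵀ = ᵀ-below-meet x⊆f y⊆g (ᵀ-sym (xyᵀᵀ⊆cᵀ (∈ᵀᵀ (x ∨ y))))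
                (proj₁ (proj₂ meet)) (proj₁ (proj₂ (proj₂ meet)))
      xyᵀ⊆mᵀᵀ : (x ∨ y) ᵀ ⊆ m ᵀᵀ
      xyᵀ⊆mᵀᵀ = ᵀ⊆ᵀᵀ-swap (λ sm → cᵀ⊆xyᵀᵀ (mᵀ⊆cᵀ sm))

    I-α : ∀ a → (∃[ x ] (x ∈ I[_] 𝐀 F × x ∈ a ᵀᵀ)) → a ∈ I[_] 𝐀 F
    I-α a (x , (f , f∈F , x⊆f) , x∈aᵀᵀ) = f , f∈F , λ ta → x⊆f (∈ᵀᵀ⇒ᵀ⊆ᵀ x∈aᵀᵀ ta)

    I-isαIdeal : IsQuasicomplemented 𝐀 → IsαIdeal 𝐀 (I[_] 𝐀 F)
    I-isαIdeal quasi = (I-downClosed , I-∨-closed quasi) , I-α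

lemma3p13 : (𝐀 : DistributiveNearlattice) → IsNormal 𝐀 → IsQuasicomplemented 𝐀 →
    (F : Subset 𝐀) → IsαFilter 𝐀 F → IsαIdeal 𝐀 (I[_] 𝐀 F)
lemma3p13 𝐀 _ quasi F (isFilter , _) = Orthogonality.I-isαIdeal 𝐀 F isFilter quasi
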